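{- For integers $n\geq k\geq 0$ let $S_{n,k}=S_k(2,1;n)+(-1)^{n+k+1}$, with the convention $S_{0,0}=0$. Then for every $k\geq 0$, $$\sum_{n\geq k}S_{n,k}x^n=\frac{1}{1+x}\,(xM(x))^{k+1},$$ where $M(x)=\sum_{n\geq0}m_nx^n$ is the generating function of the Motzkin numbers. Equivalently, the lower triangular array $(S_{n,k})_{n,k\geq 0}$ is the Riordan array $\left(\frac{xM(x)}{1+x},\,xM(x)\right)$.
   Context: $S_k(2,1;n)$ is the number of standard Young tableaux whose shape is a partition $\lambda$ of $n$ with $\lambda_3\leq 1$ (i.e. $\lambda=(\lambda_1,\lambda_2,1,\dots,1)$) and $\lambda_1-\lambda_2=k$. The Motzkin number $m_n$ is the number of lattice paths from $(0,0)$ to $(n,0)$ with steps $(1,1),(1,-1),(1,0)$ never going below the $x$-axis. A Riordan array $(g(x),f(x))$ is the lower triangular array whose $(n,k)$ entry is $[x^n]\,g(x)f(x)^k$. -}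

module Defs where

open import Data.Nat using (ℕ; zero; suc; _+_; _*_; _∸_; _≤ᵇ_)
open import Data.Bool using (Bool; true; false; _∧_; _∨_; if_then_else_)
open import Data.Integer as ℤ using (ℤ; +_; -_)

-- A triple (a,b,c) encodes the partition (a, b, 1, …, 1) with c ones.
-- It is a genuine partition iff b ≤ a and (c = 0 or b ≥ 1).

isZero : ℕ → Bool
isZero zero    = true
isZero (suc _) = false

validShape : ℕ → ℕ → ℕ → Bool
validShape a b c = (b ≤ᵇ a) ∧ (isZero c ∨ (1 ≤ᵇ b))

guard : Bool → ℕ → ℕ
guard true  n = n
guard false _ = 0

onPred : (ℕ → ℕ) → ℕ → ℕ
onPred f zero    = 0
onPred f (suc m) = f m

-- Number of standard Young tableaux of shape (a,b,1^c), computed with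
-- fuel (= a+b+c) by removing the cell containing the largest entry,
-- which must be a corner: f^λ = Σ_{corners} f^{λ - corner},
-- with f = 0 on non-partitions and f^∅ = 1.
sytFuel : ℕ → ℕ → ℕ → ℕ → ℕ
sytFuel zero    a b c = guard (isZero a ∧ isZero b ∧ isZero c) 1
sytFuel (suc n) a b c =
  guard (validShape a b c)
    ( onPred (λ a' → sytFuel n a' b c) a
    + onPred (λ b' → sytFuel n a b' c) b
    + onPred (λ c' → sytFuel n a b c') c)

syt : ℕ → ℕ → ℕ → ℕ
syt a b c = sytFuel (a + b + c) a b c

sumTo : ℕ → (ℕ → ℕ) → ℕ
sumTo zero    f = f 0
sumTo (suc n) f = sumTo n f + f (suc n)

-- S_k(2,1;n): number of SYT of shape λ ⊢ n with λ₃ ≤ 1 and λ₁ - λ₂ = k.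
-- Such λ are (b+k, b, 1^c) with 2b + k + c = n; we sum over b.
S21 : ℕ → ℕ → ℕ
S21 k n = sumTo n (λ b → guard ((b + b + k) ≤ᵇ n) (syt (b + k) b (n ∸ (b + b + k))))

-- Motzkin numbers: number of lattice paths with steps U, D, H
-- never going below the x-axis.
-- motzPaths l h = number of such paths of length l starting at height h
-- and ending at height 0.
motzPaths : ℕ → ℕ → ℕ
motzPaths zero    zero    = 1
motzPaths zero    (suc h) = 0
motzPaths (suc l) zero    = motzPaths l 1 + motzPaths l 0
motzPaths (suc l) (suc h) = motzPaths l (suc (suc h)) + motzPaths l (suc h) + motzPaths l h

motzkin : ℕ → ℕ
motzkin n = motzPaths n 0

Series : Set
Series = ℕ → ℤ

sumℤ : ℕ → (ℕ → ℤ) → ℤ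
sumℤ zero    f = f 0
sumℤ (suc n) f = sumℤ n f ℤ.+ f (suc n)

_⊛_ : Series → Series → Series
(f ⊛ g) n = sumℤ n (λ i → f i ℤ.* g (n ∸ i))

oneS : Series
oneS zero    = + 1
oneS (suc _) = + 0

powS : Series → ℕ → Series
powS f zero    = oneS
powS f (suc k) = powS f k ⊛ f

alt : ℕ → ℤ
alt zero    = + 1
alt (suc n) = - alt n

inv1plusX : Series
inv1plusX n = alt n

MotzkinGF : Series
MotzkinGF n = + motzkin n

xM : Series
xM zero    = + 0
xM (suc n) = MotzkinGF n

Snk : ℕ → ℕ → ℤ
Snk zero zero = + 0
Snk n    k    = (+ S21 k n) ℤ.+ alt (n + k + 1)

columnGF : ℕ → Series
columnGF k n = if k ≤ᵇ n then Snk n k else + 0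

{-# OPTIONS --safe #-}
-- Multiplying by 1 + x, the claim becomes S_{n+1,k} + S_{n,k} = [x^{n+1}] (xM)^{k+1}, which is
-- the number P(n, k) of Motzkin paths of length n from height k down to 0. For k ≤ n the signs
-- cancel, and the remaining cases reduce to S_{k,k} = 0. Removing the largest entry of a tableau
-- (from the first row, the second row or the column) gives, with s_k(n) = S_k(2,1;n),
--   s_k(n+1) + [n = k] = s_{k-1}(n) + s_{k+1}(n) + s_k(n),
-- the correction coming from the one-row shape (k). This is the first-step recurrence of P, so
-- induction on n yields s_k(n+1) + s_k(n) = P(n, k) + [n + 1 = k].
module Submission where

open import Defs
open import Data.Nat using (ℕ; suc)
open import Relation.Binary.PropositionalEquality using (_≡_; sym; trans)
open import Algebra.Structures using (IsCommutativeMonoid)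
open import Algebra.Bundles using (CommutativeSemigroup)
open import Level using (0ℓ)

module FiniteSums
  {A : Set} {_∙_ : A → A → A} {ε : A}
  (isCommutativeMonoid : IsCommutativeMonoid _≡_ _∙_ ε)
  (Σ : ℕ → (ℕ → A) → A)
  (Σ-base : ∀ f → Σ 0 f ≡ f 0)
  (Σ-step : ∀ n f → Σ (suc n) f ≡ Σ n f ∙ f (suc n))
  where

  open import Data.Nat using (zero)
  open import Relation.Binary.PropositionalEquality using (sym; trans; cong; cong₂)
  open IsCommutativeMonoid isCommutativeMonoid using (assoc; identityʳ; isCommutativeSemigroup)

  commutativeSemigroup : CommutativeSemigroup 0ℓ 0ℓ
  commutativeSemigroup = record { isCommutativeSemigroup = isCommutativeSemigroup }

  open import Algebra.Properties.CommutativeSemigroup commutativeSemigroup using (interchange)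

  Σ-tail : ∀ n f → Σ (suc n) f ≡ f 0 ∙ Σ n (λ i → f (suc i))
  Σ-tail zero    f = trans (Σ-step 0 f) (cong₂ _∙_ (Σ-base f) (sym (Σ-base _)))
  Σ-tail (suc n) f =
    trans (Σ-step (suc n) f)
      (trans (cong (_∙ f (suc (suc n))) (Σ-tail n f))
        (trans (assoc _ _ _) (cong (f 0 ∙_) (sym (Σ-step n _)))))

  Σ-cong : ∀ n {f g} → (∀ i → f i ≡ g i) → Σ n f ≡ Σ n g
  Σ-cong zero    f≗g = trans (Σ-base _) (trans (f≗g 0) (sym (Σ-base _)))
  Σ-cong (suc n) f≗g =
    trans (Σ-step n _) (trans (cong₂ _∙_ (Σ-cong n f≗g) (f≗g (suc n))) (sym (Σ-step n _)))

  Σ-∙ : ∀ n f g → Σ n (λ i → f i ∙ g i) ≡ Σ n f ∙ Σ n g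
  Σ-∙ zero    f g = trans (Σ-base _) (sym (cong₂ _∙_ (Σ-base f) (Σ-base g)))
  Σ-∙ (suc n) f g =
    trans (Σ-step n _)
      (trans (cong (_∙ (f (suc n) ∙ g (suc n))) (Σ-∙ n f g))
        (trans (interchange _ _ _ _) (sym (cong₂ _∙_ (Σ-step n f) (Σ-step n g)))))

  Σ-ε : ∀ n {f} → (∀ i → f i ≡ ε) → Σ n f ≡ ε
  Σ-ε zero    f≗ε = trans (Σ-base _) (f≗ε 0)
  Σ-ε (suc n) f≗ε =
    trans (Σ-step n _) (trans (cong₂ _∙_ (Σ-ε n f≗ε) (f≗ε (suc n))) (identityʳ ε))

  Σ-homo : (h : A → A) → (∀ x y → h (x ∙ y) ≡ h x ∙ h y) →
           ∀ n f → Σ n (λ i → h (f i)) ≡ h (Σ n f)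
  Σ-homo h h-∙ zero    f = trans (Σ-base _) (cong h (sym (Σ-base f)))
  Σ-homo h h-∙ (suc n) f =
    trans (Σ-step n _)
      (trans (cong (_∙ h (f (suc n))) (Σ-homo h h-∙ n f))
        (trans (sym (h-∙ _ _)) (cong h (sym (Σ-step n f)))))

module MotzkinPaths where

  open import Data.Nat using (zero; _+_; _<_; s≤s)
  open import Data.Nat.Properties using (+-comm; +-assoc; m<n⇒m<1+n)
  open import Relation.Binary.PropositionalEquality using (refl; sym; trans; cong₂)

  motzPaths-suc : ∀ l h →
    motzPaths (suc l) h ≡ onPred (motzPaths l) h + motzPaths l (suc h) + motzPaths l h
  motzPaths-suc l zero    = refl
  motzPaths-suc l (suc h) = trans (+-comm _ (motzPaths l h)) (sym (+-assoc (motzPaths l h) _ _))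

  motzPaths-high : ∀ {l h} → l < h → motzPaths l h ≡ 0
  motzPaths-high {zero}  {suc h} _         = refl
  motzPaths-high {suc l} {suc h} (s≤s l<h) =
    cong₂ _+_ (cong₂ _+_ (motzPaths-high (m<n⇒m<1+n (m<n⇒m<1+n l<h)))
                         (motzPaths-high (m<n⇒m<1+n l<h)))
              (motzPaths-high l<h)

module Tableaux where

  open import Data.Nat using (zero; _+_; _∸_; _≤_; _<_; _≤ᵇ_; _<ᵇ_; s≤s)
  open import Data.Nat.Properties
    using (+-suc; +-identityʳ; m≤m+n; m≤n+m; ≤-trans; ≤⇒≤ᵇ; +-cancelʳ-≡; +-0-isCommutativeMonoid)
  open import Data.Nat.Tactic.RingSolver using (solve-∀)
  open import Data.Bool using (true; false; _∧_; _∨_)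
  open import Data.Bool.Properties using (T-≡; ∨-zeroʳ)
  open import Function using (Equivalence)
  open import Relation.Binary.PropositionalEquality
    using (refl; sym; trans; cong; cong₂; module ≡-Reasoning)
  open FiniteSums +-0-isCommutativeMonoid sumTo (λ _ → refl) (λ _ _ → refl)
    renaming (Σ-tail to sumTo-tail; Σ-cong to sumTo-cong; Σ-∙ to sumTo-+; Σ-ε to sumTo-zero)
  open MotzkinPaths using (motzPaths-suc)

  δ : ℕ → ℕ → ℕ
  δ zero    zero    = 1
  δ zero    (suc n) = 0
  δ (suc m) zero    = 0
  δ (suc m) (suc n) = δ m n

  δ-refl : ∀ n → δ n n ≡ 1
  δ-refl zero    = refl
  δ-refl (suc n) = δ-refl n

  δ-> : ∀ {m n} → n < m → δ m n ≡ 0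
  δ-> {suc m} {zero}  _         = refl
  δ-> {suc m} {suc n} (s≤s n<m) = δ-> n<m

  onPred-cong : ∀ {f g} k → (∀ i → f i ≡ g i) → onPred f k ≡ onPred g k
  onPred-cong zero    f≗g = refl
  onPred-cong (suc k) f≗g = f≗g k

  onPred-+ : ∀ f g k → onPred (λ i → f i + g i) k ≡ onPred f k + onPred g k
  onPred-+ f g zero    = refl
  onPred-+ f g (suc k) = refl

  onPred-δ : ∀ n k → onPred (δ n) k ≡ δ (suc n) k
  onPred-δ n zero    = refl
  onPred-δ n (suc k) = refl

  onExcess : ℕ → (ℕ → ℕ) → ℕ → ℕ
  onExcess m f n = guard (m ≤ᵇ n) (f (n ∸ m))

  onExcess-suc : ∀ m f n → onExcess (suc m) f (suc n) ≡ onExcess m f n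
  onExcess-suc zero    f n = refl
  onExcess-suc (suc m) f n = refl

  onExcess-< : ∀ {m n} f → n < m → onExcess m f n ≡ 0
  onExcess-< {suc m} {zero}  f _         = refl
  onExcess-< {suc m} {suc n} f (s≤s n<m) = trans (onExcess-suc m f n) (onExcess-< f n<m)

  onExcess-cong : ∀ m {f g} n → (∀ c → f c ≡ g c) → onExcess m f n ≡ onExcess m g n
  onExcess-cong m n f≗g = cong (guard (m ≤ᵇ n)) (f≗g (n ∸ m))

  onExcess-+ : ∀ m f g n → onExcess m (λ c → f c + g c) n ≡ onExcess m f n + onExcess m g n
  onExcess-+ m f g n with m ≤ᵇ n
  ... | true  = refl
  ... | false = refl

  onExcess-0 : ∀ m n → onExcess m (λ _ → 0) n ≡ 0
  onExcess-0 m n with m ≤ᵇ n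
  ... | true  = refl
  ... | false = refl

  onExcess-onPred : ∀ m f n → onExcess m (onPred f) n ≡ onExcess (suc m) f n
  onExcess-onPred zero    f zero    = refl
  onExcess-onPred zero    f (suc n) = refl
  onExcess-onPred (suc m) f zero    = refl
  onExcess-onPred (suc m) f (suc n) =
    trans (onExcess-suc m (onPred f) n)
      (trans (onExcess-onPred m f n) (sym (onExcess-suc (suc m) f n)))

  onExcess-δ : ∀ m n → onExcess m (λ c → δ c 0) n ≡ δ n m
  onExcess-δ zero    n       = refl
  onExcess-δ (suc m) zero    = refl
  onExcess-δ (suc m) (suc n) = trans (onExcess-suc m (λ c → δ c 0) n) (onExcess-δ m n)

  guard-true : ∀ {v x} → v ≡ true → guard v x ≡ x
  guard-true refl = refl

  guard-false : ∀ {v x} → v ≡ false → guard v x ≡ 0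
  guard-false refl = refl

  <ᵇ-irrefl : ∀ n → (n <ᵇ n) ≡ false
  <ᵇ-irrefl zero    = refl
  <ᵇ-irrefl (suc n) = <ᵇ-irrefl n

  syt-suc : ∀ a b c → syt (suc a) b c ≡
    guard (validShape (suc a) b c)
      (syt a b c + onPred (λ b′ → syt (suc a) b′ c) b + onPred (syt (suc a) b) c)
  syt-suc a b c = cong (guard (validShape (suc a) b c))
                       (cong₂ _+_ (cong (syt a b c +_) (secondRow b)) (column c))
    where
    secondRow : ∀ b′ → onPred (λ b″ → sytFuel (a + b′ + c) (suc a) b″ c) b′
                     ≡ onPred (λ b″ → syt (suc a) b″ c) b′
    secondRow zero     = refl
    secondRow (suc b′) = cong (λ m → sytFuel m (suc a) b′ c) (cong (_+ c) (+-suc a b′))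
    column : ∀ c′ → onPred (λ c″ → sytFuel (a + b + c′) (suc a) b c″) c′ ≡ onPred (syt (suc a) b) c′
    column zero     = refl
    column (suc c′) = cong (λ m → sytFuel m (suc a) b c′) (+-suc (a + b) c′)

  syt-oneRow : ∀ a c → syt a 0 c ≡ δ c 0
  syt-oneRow zero    zero    = refl
  syt-oneRow (suc a) zero    =
    trans (syt-suc a 0 0) (trans (+-identityʳ _) (trans (+-identityʳ _) (syt-oneRow a 0)))
  syt-oneRow zero    (suc c) = refl
  syt-oneRow (suc a) (suc c) = refl

  syt-overhang : ∀ b c → syt b (suc b) c ≡ 0
  syt-overhang zero    c = refl
  syt-overhang (suc b) c =
    trans (syt-suc b (suc (suc b)) c) (guard-false (cong (_∧ (isZero c ∨ true)) (<ᵇ-irrefl b)))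

  validShape-twoRows : ∀ {a b} c → suc b ≤ a → validShape a (suc b) c ≡ true
  validShape-twoRows c b<a = cong₂ _∧_ (Equivalence.to T-≡ (≤⇒≤ᵇ b<a)) (∨-zeroʳ _)

  syt-twoRows : ∀ k b c → syt (suc b + k) (suc b) c ≡
    onPred (λ k′ → syt (suc b + k′) (suc b) c) k + syt (b + suc k) b c
      + onPred (syt (suc b + k) (suc b)) c
  syt-twoRows k b c =
    trans (syt-suc (b + k) (suc b) c)
      (trans (guard-true (validShape-twoRows c (s≤s (m≤m+n b k))))
        (cong₂ (λ x y → x + y + onPred (syt (suc b + k) (suc b)) c)
               (firstRow k) (cong (λ a → syt a b c) (sym (+-suc b k)))))
    where
    firstRow : ∀ k → syt (b + k) (suc b) c ≡ onPred (λ k′ → syt (suc b + k′) (suc b) c) k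
    firstRow zero    = trans (cong (λ a → syt a (suc b) c) (+-identityʳ b)) (syt-overhang b c)
    firstRow (suc k) = cong (λ a → syt a (suc b) c) (+-suc b k)

  -- S21 k n unfolds to sumTo n (S21Term k n); b is the length of the second row.
  S21Term : ℕ → ℕ → ℕ → ℕ
  S21Term k n b = onExcess (b + b + k) (syt (b + k) b) n

  S21Term-oneRow : ∀ k n → S21Term k n 0 ≡ δ n k
  S21Term-oneRow k n = trans (onExcess-cong k n (syt-oneRow k)) (onExcess-δ k n)

  S21Term-suc : ∀ k n b → S21Term k (suc n) (suc b) ≡
    onPred (λ k′ → S21Term k′ n (suc b)) k + S21Term (suc k) n b + S21Term k n (suc b)
  S21Term-suc k n b = begin
      onExcess (suc X) (syt (suc b + k) (suc b)) (suc n)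
    ≡⟨ onExcess-suc X (syt (suc b + k) (suc b)) n ⟩
      onExcess X (syt (suc b + k) (suc b)) n
    ≡⟨ onExcess-cong X n (syt-twoRows k b) ⟩
      onExcess X (λ c → fromFirstRow c + fromSecondRow c + fromColumn c) n
    ≡⟨ trans (onExcess-+ X (λ c → fromFirstRow c + fromSecondRow c) fromColumn n)
             (cong (_+ onExcess X fromColumn n) (onExcess-+ X fromFirstRow fromSecondRow n)) ⟩
      onExcess X fromFirstRow n + onExcess X fromSecondRow n + onExcess X fromColumn n
    ≡⟨ cong₂ _+_ (cong₂ _+_ (firstRow k) (cong (λ m → onExcess m fromSecondRow n) secondRow))
                 (onExcess-onPred X (syt (suc b + k) (suc b)) n) ⟩
      onPred (λ k′ → S21Term k′ n (suc b)) k + S21Term (suc k) n b + S21Term k n (suc b)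
    ∎
    where
    open ≡-Reasoning
    X = b + suc b + k
    fromFirstRow fromSecondRow fromColumn : ℕ → ℕ
    fromFirstRow c = onPred (λ k′ → syt (suc b + k′) (suc b) c) k
    fromSecondRow  = syt (b + suc k) b
    fromColumn     = onPred (syt (suc b + k) (suc b))
    firstRow : ∀ k → onExcess (b + suc b + k) (λ c → onPred (λ k′ → syt (suc b + k′) (suc b) c) k) n
                   ≡ onPred (λ k′ → S21Term k′ n (suc b)) k
    firstRow zero    = onExcess-0 (b + suc b + 0) n
    firstRow (suc k) = cong (λ m → onExcess m (syt (suc b + k) (suc b)) n) (+-suc (b + suc b) k)
    secondRow : b + suc b + k ≡ b + b + suc k
    secondRow = trans (cong (_+ k) (+-suc b b)) (sym (+-suc (b + b) k))

  S21⁺ : ℕ → ℕ → ℕ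
  S21⁺ k n = sumTo n (λ b → S21Term k n (suc b))

  S21-split : ∀ k n → S21 k n ≡ δ n k + S21⁺ k n
  S21-split k n = begin
      S21 k n
    ≡⟨ sym (+-identityʳ _) ⟩
      S21 k n + 0
    ≡⟨ cong (S21 k n +_) (sym (onExcess-< (syt (suc n + k) (suc n)) n<2n+2+k)) ⟩
      sumTo (suc n) (S21Term k n)
    ≡⟨ sumTo-tail n _ ⟩
      S21Term k n 0 + S21⁺ k n
    ≡⟨ cong (_+ S21⁺ k n) (S21Term-oneRow k n) ⟩
      δ n k + S21⁺ k n
    ∎
    where
    open ≡-Reasoning
    n<2n+2+k : n < suc n + suc n + k
    n<2n+2+k = s≤s (≤-trans (m≤m+n n (suc n)) (m≤m+n _ k))

  S21-diagonal : ∀ k → S21 k k ≡ 1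
  S21-diagonal k =
    trans (S21-split k k)
      (cong₂ _+_ (δ-refl k)
        (sumTo-zero k (λ b → onExcess-< (syt (suc b + k) (suc b)) (s≤s (m≤n+m k (b + suc b))))))

  sumTo-onPred : ∀ n (F : ℕ → ℕ → ℕ) k →
    sumTo n (λ b → onPred (λ k′ → F k′ b) k) ≡ onPred (λ k′ → sumTo n (F k′)) k
  sumTo-onPred n F zero    = sumTo-zero n (λ _ → refl)
  sumTo-onPred n F (suc k) = refl

  S21-suc : ∀ k n →
    S21 k (suc n) + δ n k ≡ onPred (λ k′ → S21 k′ n) k + S21 (suc k) n + S21 k n
  S21-suc k n = begin
      S21 k (suc n) + δ n k
    ≡⟨ cong (_+ δ n k) (sumTo-tail n _) ⟩
      S21Term k (suc n) 0 + sumTo n (λ b → S21Term k (suc n) (suc b)) + δ n k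
    ≡⟨ cong (_+ δ n k) (cong₂ _+_ (S21Term-oneRow k (suc n)) (sumTo-cong n (S21Term-suc k n))) ⟩
      δ (suc n) k + sumTo n (λ b → onPred (λ k′ → S21Term k′ n (suc b)) k
                                    + S21Term (suc k) n b + S21Term k n (suc b)) + δ n k
    ≡⟨ cong (λ x → δ (suc n) k + x + δ n k)
            (trans (sumTo-+ n _ _)
                   (cong (_+ S21⁺ k n) (trans (sumTo-+ n _ _)
                                              (cong (_+ S21 (suc k) n) (sumTo-onPred n _ k))))) ⟩
      δ (suc n) k + (onPred (λ k′ → S21⁺ k′ n) k + S21 (suc k) n + S21⁺ k n) + δ n k
    ≡⟨ regroup (δ (suc n) k) _ (S21 (suc k) n) _ (δ n k) ⟩
      δ (suc n) k + onPred (λ k′ → S21⁺ k′ n) k + S21 (suc k) n + (δ n k + S21⁺ k n)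
    ≡⟨ cong₂ (λ x y → x + S21 (suc k) n + y) (sym (splitBelow k)) (sym (S21-split k n)) ⟩
      onPred (λ k′ → S21 k′ n) k + S21 (suc k) n + S21 k n
    ∎
    where
    open ≡-Reasoning
    regroup : ∀ d p s q e → d + (p + s + q) + e ≡ d + p + s + (e + q)
    regroup = solve-∀
    splitBelow : ∀ k → onPred (λ k′ → S21 k′ n) k ≡ δ (suc n) k + onPred (λ k′ → S21⁺ k′ n) k
    splitBelow zero    = refl
    splitBelow (suc k) = S21-split k n

  -- Both sides satisfy the recurrence of S21-suc, inhomogeneous terms included.
  S21-adjacentSum : ∀ n k → S21 k (suc n) + S21 k n ≡ motzPaths n k + δ (suc n) k
  S21-adjacentSum zero    zero          = refl
  S21-adjacentSum zero    (suc zero)    = refl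
  S21-adjacentSum zero    (suc (suc k)) = refl
  S21-adjacentSum (suc n) k = +-cancelʳ-≡ (δ (suc n) k + δ n k) _ _ (begin
      S21 k (2 + n) + S21 k (1 + n) + (δ (1 + n) k + δ n k)
    ≡⟨ interchange (S21 k (2 + n)) _ _ _ ⟩
      (S21 k (2 + n) + δ (1 + n) k) + (S21 k (1 + n) + δ n k)
    ≡⟨ cong₂ _+_ (S21-suc k (suc n)) (S21-suc k n) ⟩
      (onPred (λ j → S21 j (1 + n)) k + S21 (1 + k) (1 + n) + S21 k (1 + n))
        + (onPred (λ j → S21 j n) k + S21 (1 + k) n + S21 k n)
    ≡⟨ interchange₃ (onPred (λ j → S21 j (1 + n)) k) _ _ _ _ _ ⟩
      (onPred (λ j → S21 j (1 + n)) k + onPred (λ j → S21 j n) k)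
        + (S21 (1 + k) (1 + n) + S21 (1 + k) n) + (S21 k (1 + n) + S21 k n)
    ≡⟨ cong₂ _+_ (cong₂ _+_ (trans (sym (onPred-+ _ _ k)) (onPred-cong k (S21-adjacentSum n)))
                             (S21-adjacentSum n (suc k)))
                 (S21-adjacentSum n k) ⟩
      onPred (λ j → motzPaths n j + δ (1 + n) j) k
        + (motzPaths n (1 + k) + δ n k) + (motzPaths n k + δ (1 + n) k)
    ≡⟨ cong (λ x → x + (motzPaths n (1 + k) + δ n k) + (motzPaths n k + δ (1 + n) k))
            (trans (onPred-+ (motzPaths n) (δ (1 + n)) k)
                   (cong (onPred (motzPaths n) k +_) (onPred-δ (suc n) k))) ⟩
      (onPred (motzPaths n) k + δ (2 + n) k)
        + (motzPaths n (1 + k) + δ n k) + (motzPaths n k + δ (1 + n) k)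
    ≡⟨ collect (onPred (motzPaths n) k) _ _ _ _ _ ⟩
      onPred (motzPaths n) k + motzPaths n (1 + k) + motzPaths n k + δ (2 + n) k
        + (δ (1 + n) k + δ n k)
    ≡⟨ cong (λ x → x + δ (2 + n) k + (δ (1 + n) k + δ n k)) (sym (motzPaths-suc n k)) ⟩
      motzPaths (1 + n) k + δ (2 + n) k + (δ (1 + n) k + δ n k)
    ∎)
    where
    open ≡-Reasoning
    interchange : ∀ a b c d → a + b + (c + d) ≡ (a + c) + (b + d)
    interchange = solve-∀
    interchange₃ : ∀ a b c d e f → (a + b + c) + (d + e + f) ≡ (a + d) + (b + e) + (c + f)
    interchange₃ = solve-∀
    collect : ∀ p x u e m y → (p + x) + (u + e) + (m + y) ≡ p + u + m + x + (y + e)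
    collect = solve-∀

module PowerSeries where

  open import Data.Nat as ℕ using (zero; _∸_)
  open import Data.Integer using (+_; -_; _+_; _*_)
  open import Data.Integer.Properties
    using (+-0-isCommutativeMonoid; +-identityˡ; +-identityʳ; *-identityˡ; *-zeroʳ;
           *-distribʳ-+; neg-distrib-+; neg-distribˡ-*; pos-+)
  open import Data.Integer.Tactic.RingSolver using (solve-∀)
  open import Relation.Binary.PropositionalEquality
    using (refl; sym; trans; cong; cong₂; module ≡-Reasoning)
  open FiniteSums +-0-isCommutativeMonoid sumℤ (λ _ → refl) (λ _ _ → refl)
    renaming (Σ-tail to sumℤ-tail; Σ-cong to sumℤ-cong; Σ-∙ to sumℤ-+; Σ-ε to sumℤ-zero;
              Σ-homo to sumℤ-homo)

  infixl 6 _⊕_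
  _⊕_ : Series → Series → Series
  (f ⊕ g) n = f n + g n

  shift : Series → Series
  shift f zero    = + 0
  shift f (suc n) = f n

  ⊛-tail : ∀ f g n → (f ⊛ g) (suc n) ≡ f 0 * g (suc n) + ((λ i → f (suc i)) ⊛ g) n
  ⊛-tail f g n = sumℤ-tail n _

  ⊛-congˡ : ∀ {f f′} g n → (∀ i → f i ≡ f′ i) → (f ⊛ g) n ≡ (f′ ⊛ g) n
  ⊛-congˡ g n f≗f′ = sumℤ-cong n (λ i → cong (_* g (n ∸ i)) (f≗f′ i))

  ⊛-distribʳ-⊕ : ∀ f g h n → ((f ⊕ g) ⊛ h) n ≡ (f ⊛ h) n + (g ⊛ h) n
  ⊛-distribʳ-⊕ f g h n =
    trans (sumℤ-cong n (λ i → *-distribʳ-+ (h (n ∸ i)) (f i) (g i))) (sumℤ-+ n _ _)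

  ⊛-identityˡ : ∀ f n → (oneS ⊛ f) n ≡ f n
  ⊛-identityˡ f zero    = *-identityˡ (f 0)
  ⊛-identityˡ f (suc n) =
    trans (⊛-tail oneS f n)
      (trans (cong₂ _+_ (*-identityˡ (f (suc n))) (sumℤ-zero n (λ _ → refl)))
        (+-identityʳ (f (suc n))))

  shift-⊛ : ∀ f g n → (shift f ⊛ g) (suc n) ≡ (f ⊛ g) n
  shift-⊛ f g n = trans (⊛-tail (shift f) g n) (+-identityˡ _)

  paths : ℕ → Series
  paths h l = + motzPaths l h

  pos-+₃ : ∀ a b c → + (a ℕ.+ b ℕ.+ c) ≡ + a + + b + + c
  pos-+₃ a b c = trans (pos-+ (a ℕ.+ b) c) (cong (_+ + c) (pos-+ a b))

  -- First-passage decomposition at height h, proved by induction along the first-step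
  -- recursion of motzPaths.
  paths-⊛-xM : ∀ n h → (paths h ⊛ xM) n ≡ paths (suc h) n
  paths-⊛-xM zero    h       = *-zeroʳ (paths h 0)
  paths-⊛-xM (suc n) zero    = begin
      (paths 0 ⊛ xM) (suc n)
    ≡⟨ ⊛-tail (paths 0) xM n ⟩
      + 1 * xM (suc n) + ((λ i → paths 0 (suc i)) ⊛ xM) n
    ≡⟨ cong₂ _+_ (*-identityˡ (xM (suc n)))
                 (⊛-congˡ xM n (λ i → pos-+ (motzPaths i 1) (motzPaths i 0))) ⟩
      + motzPaths n 0 + ((paths 1 ⊕ paths 0) ⊛ xM) n
    ≡⟨ cong (_+_ (+ motzPaths n 0)) (⊛-distribʳ-⊕ (paths 1) (paths 0) xM n) ⟩
      + motzPaths n 0 + ((paths 1 ⊛ xM) n + (paths 0 ⊛ xM) n)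
    ≡⟨ cong (_+_ (+ motzPaths n 0)) (cong₂ _+_ (paths-⊛-xM n 1) (paths-⊛-xM n 0)) ⟩
      + motzPaths n 0 + (+ motzPaths n 2 + + motzPaths n 1)
    ≡⟨ rotate (+ motzPaths n 0) (+ motzPaths n 2) (+ motzPaths n 1) ⟩
      + motzPaths n 2 + + motzPaths n 1 + + motzPaths n 0
    ≡⟨ sym (pos-+₃ (motzPaths n 2) _ _) ⟩
      paths 1 (suc n)
    ∎
    where
    open ≡-Reasoning
    rotate : ∀ a b c → a + (b + c) ≡ b + c + a
    rotate = solve-∀
  paths-⊛-xM (suc n) (suc h) = begin
      (paths (suc h) ⊛ xM) (suc n)
    ≡⟨ trans (⊛-tail (paths (suc h)) xM n) (+-identityˡ _) ⟩
      ((λ i → paths (suc h) (suc i)) ⊛ xM) n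
    ≡⟨ ⊛-congˡ xM n (λ i → pos-+₃ (motzPaths i (suc (suc h))) _ _) ⟩
      ((paths (suc (suc h)) ⊕ paths (suc h) ⊕ paths h) ⊛ xM) n
    ≡⟨ trans (⊛-distribʳ-⊕ (paths (suc (suc h)) ⊕ paths (suc h)) (paths h) xM n)
             (cong (_+ (paths h ⊛ xM) n) (⊛-distribʳ-⊕ (paths (suc (suc h))) (paths (suc h)) xM n)) ⟩
      (paths (suc (suc h)) ⊛ xM) n + (paths (suc h) ⊛ xM) n + (paths h ⊛ xM) n
    ≡⟨ cong₂ _+_ (cong₂ _+_ (paths-⊛-xM n (suc (suc h))) (paths-⊛-xM n (suc h))) (paths-⊛-xM n h) ⟩
      paths (suc (suc (suc h))) n + paths (suc (suc h)) n + paths (suc h) n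
    ≡⟨ sym (pos-+₃ (motzPaths n (suc (suc (suc h)))) _ _) ⟩
      paths (suc (suc h)) (suc n)
    ∎
    where open ≡-Reasoning

  powS-xM : ∀ k n → powS xM (suc k) n ≡ shift (paths k) n
  powS-xM zero    n       = trans (⊛-identityˡ xM n) (xM≡shift n)
    where
    xM≡shift : ∀ n → xM n ≡ shift (paths 0) n
    xM≡shift zero    = refl
    xM≡shift (suc n) = refl
  powS-xM (suc k) zero    = *-zeroʳ (powS xM (suc k) 0)
  powS-xM (suc k) (suc n) =
    trans (⊛-congˡ xM (suc n) (powS-xM k))
      (trans (shift-⊛ (paths k) xM n) (paths-⊛-xM n k))

  inv1plusX-⊛-step : ∀ q n → (inv1plusX ⊛ q) (suc n) + (inv1plusX ⊛ q) n ≡ q (suc n)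
  inv1plusX-⊛-step q n = begin
      (inv1plusX ⊛ q) (suc n) + p
    ≡⟨ cong (_+ p) (⊛-tail inv1plusX q n) ⟩
      + 1 * q (suc n) + ((λ i → - alt i) ⊛ q) n + p
    ≡⟨ cong (λ x → + 1 * q (suc n) + x + p)
            (trans (sumℤ-cong n (λ i → sym (neg-distribˡ-* (alt i) _)))
                   (sumℤ-homo -_ neg-distrib-+ n _)) ⟩
      + 1 * q (suc n) + - p + p
    ≡⟨ cancel (q (suc n)) p ⟩
      q (suc n)
    ∎
    where
    open ≡-Reasoning
    p = (inv1plusX ⊛ q) n
    cancel : ∀ a p → + 1 * a + - p + p ≡ a
    cancel = solve-∀

  inv1plusX-⊛-unique : ∀ (c q : Series) → c 0 ≡ q 0 → (∀ n → c (suc n) + c n ≡ q (suc n)) →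
                       ∀ n → c n ≡ (inv1plusX ⊛ q) n
  inv1plusX-⊛-unique c q c₀≡q₀ step zero    = trans c₀≡q₀ (sym (*-identityˡ (q 0)))
  inv1plusX-⊛-unique c q c₀≡q₀ step (suc n) = begin
      c (suc n)
    ≡⟨ sym (+-neg-cancelʳ (c (suc n)) (c n)) ⟩
      c (suc n) + c n + - c n
    ≡⟨ cong₂ (λ x y → x + - y) (step n) (inv1plusX-⊛-unique c q c₀≡q₀ step n) ⟩
      q (suc n) + - p n
    ≡⟨ cong (_+ - p n) (sym (inv1plusX-⊛-step q n)) ⟩
      p (suc n) + p n + - p n
    ≡⟨ +-neg-cancelʳ (p (suc n)) (p n) ⟩
      p (suc n)
    ∎
    where
    open ≡-Reasoning
    p = inv1plusX ⊛ q
    +-neg-cancelʳ : ∀ a b → a + b + - b ≡ a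
    +-neg-cancelʳ = solve-∀

module Columns where

  open import Data.Nat as ℕ using (zero; _≤_; _<_; _≤ᵇ_; s≤s⁻¹)
  open import Data.Nat.Properties
    using (<-cmp; ≤-refl; <⇒≤; <-trans; n<1+n; ≤⇒≤ᵇ; ≤ᵇ⇒≤; <⇒≱; +-suc; +-identityʳ)
  open import Data.Integer using (+_; -_; _+_)
  open import Data.Integer.Properties using (neg-involutive; pos-+)
  open import Data.Integer.Tactic.RingSolver using (solve-∀)
  open import Data.Bool using (true; false)
  open import Data.Empty using (⊥-elim)
  open import Relation.Binary using (tri<; tri≈; tri>)
  open import Relation.Binary.PropositionalEquality
    using (refl; sym; trans; cong; cong₂; module ≡-Reasoning)
  open MotzkinPaths using (motzPaths-high)
  open Tableaux using (δ; δ->; S21-adjacentSum; S21-diagonal)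

  alt-odd : ∀ m → alt (m ℕ.+ m ℕ.+ 1) ≡ - + 1
  alt-odd zero    = refl
  alt-odd (suc m) =
    trans (cong (λ j → - alt (j ℕ.+ 1)) (+-suc m m)) (trans (neg-involutive _) (alt-odd m))

  Snk-formula : ∀ n k → Snk n k ≡ + S21 k n + alt (n ℕ.+ k ℕ.+ 1)
  Snk-formula zero    zero    = refl
  Snk-formula zero    (suc k) = refl
  Snk-formula (suc n) k       = refl

  Snk-diagonal : ∀ k → Snk k k ≡ + 0
  Snk-diagonal k =
    trans (Snk-formula k k) (cong₂ _+_ (cong +_ (S21-diagonal k)) (alt-odd k))

  columnGF-≤ : ∀ {k n} → k ≤ n → columnGF k n ≡ Snk n k
  columnGF-≤ {k} {n} k≤n with k ≤ᵇ n | ≤⇒≤ᵇ k≤n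
  ... | true | _ = refl

  columnGF-> : ∀ {k n} → n < k → columnGF k n ≡ + 0
  columnGF-> {k} {n} n<k with k ≤ᵇ n | ≤ᵇ⇒≤ k n
  ... | false | _    = refl
  ... | true  | k≤n = ⊥-elim (<⇒≱ n<k (k≤n _))

  columnGF-zero : ∀ k → columnGF k 0 ≡ + 0
  columnGF-zero zero    = refl
  columnGF-zero (suc k) = refl

  columnGF-adjacentSum : ∀ k n → columnGF k (suc n) + columnGF k n ≡ + motzPaths n k
  columnGF-adjacentSum k n with <-cmp k (suc n)
  ... | tri< k<1+n _ _ = begin
      columnGF k (suc n) + columnGF k n
    ≡⟨ cong₂ _+_ (columnGF-≤ (<⇒≤ k<1+n)) (trans (columnGF-≤ (s≤s⁻¹ k<1+n)) (Snk-formula n k)) ⟩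
      + S21 k (suc n) + - s + (+ S21 k n + s)
    ≡⟨ cancel (+ S21 k (suc n)) (+ S21 k n) s ⟩
      + S21 k (suc n) + + S21 k n
    ≡⟨ sym (pos-+ (S21 k (suc n)) _) ⟩
      + (S21 k (suc n) ℕ.+ S21 k n)
    ≡⟨ cong +_ (S21-adjacentSum n k) ⟩
      + (motzPaths n k ℕ.+ δ (suc n) k)
    ≡⟨ cong (λ d → + (motzPaths n k ℕ.+ d)) (δ-> k<1+n) ⟩
      + (motzPaths n k ℕ.+ 0)
    ≡⟨ cong +_ (+-identityʳ _) ⟩
      + motzPaths n k
    ∎
    where
    open ≡-Reasoning
    s = alt (n ℕ.+ k ℕ.+ 1)
    cancel : ∀ a b s → a + - s + (b + s) ≡ a + b
    cancel = solve-∀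
  ... | tri≈ _ refl _ =
    trans (cong₂ _+_ (trans (columnGF-≤ {suc n} ≤-refl) (Snk-diagonal k)) (columnGF-> (n<1+n n)))
          (sym (cong +_ (motzPaths-high (n<1+n n))))
  ... | tri> _ _ 1+n<k =
    trans (cong₂ _+_ (columnGF-> 1+n<k) (columnGF-> (<-trans (n<1+n n) 1+n<k)))
          (sym (cong +_ (motzPaths-high (<-trans (n<1+n n) 1+n<k))))

open PowerSeries using (powS-xM; inv1plusX-⊛-unique)
open Columns using (columnGF-zero; columnGF-adjacentSum)

lemma3p3 : (k n : ℕ) → columnGF k n ≡ (inv1plusX ⊛ powS xM (suc k)) n
lemma3p3 k = inv1plusX-⊛-unique (columnGF k) (powS xM (suc k))
  (trans (columnGF-zero k) (sym (powS-xM k 0)))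
  (λ n → trans (columnGF-adjacentSum k n) (sym (powS-xM k (suc n))))
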